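{- If $p$ is a pattern containing the pattern $10$, then $\mathcal{A}_{010,p}(n)=\mathcal{A}_{010}(n)$ for every $n\ge 1$.
   Context: An ascent of an integer word $x_1\cdots x_n$ is an index $j$ with $x_j<x_{j+1}$; $\mathrm{asc}(x_1\cdots x_n)$ denotes the number of ascents. An ascent sequence of length $n$ is a sequence $x_1\cdots x_n$ of nonnegative integers with $x_1=0$ and $x_i\le \mathrm{asc}(x_1\cdots x_{i-1})+1$ for all $1<i\le n$. A pattern is a word $p=p_1\cdots p_k$ of nonnegative integers whose set of values is $\{0,1,\dots,m\}$ for some $m$. A word $x_1\cdots x_n$ contains $p$ if there are indices $i_1<\cdots<i_k$ such that $x_{i_1}\cdots x_{i_k}$ is order-isomorphic to $p$ (i.e. for all $s,t$, $x_{i_s}<x_{i_t}$ iff $p_s<p_t$ and $x_{i_s}=x_{i_t}$ iff $p_s=p_t$); otherwise it avoids $p$. A pattern $q$ contains a pattern $p$ in the same sense. For a list $B$ of patterns, $\mathcal{A}_B(n)$ is the set of ascent sequences of length $n$ avoiding every pattern in $B$. -}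

module Defs where

open import Data.Nat using (ℕ; zero; suc; _<_; _≤_; _+_; _<ᵇ_)
open import Data.Bool using (if_then_else_)
open import Data.List using (List; []; _∷_; length; lookup)
open import Data.List.Relation.Binary.Sublist.Propositional using (_⊆_)
open import Data.Fin using (Fin)
open import Data.Product using (Σ; ∃; _×_; _,_)
open import Data.Empty using (⊥)
open import Relation.Nullary using (¬_)
open import Relation.Binary.PropositionalEquality using (_≡_; subst)
open import Function.Bundles using (_⇔_)

asc : List ℕ → ℕ
asc [] = 0
asc (x ∷ []) = 0
asc (x ∷ y ∷ xs) = (if x <ᵇ y then 1 else 0) + asc (y ∷ xs)

open import Data.List using (_∷ʳ_)

data IsAscentSeq : List ℕ → Set where
  first : IsAscentSeq (0 ∷ [])
  extend : ∀ {xs} x → IsAscentSeq xs → x ≤ suc (asc xs) → IsAscentSeq (xs ∷ʳ x)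

IsPattern : List ℕ → Set
IsPattern p = Σ ℕ λ m →
  (∀ (i : Fin (length p)) → lookup p i ≤ m) ×
  (∀ v → v ≤ m → ∃ λ (i : Fin (length p)) → lookup p i ≡ v)

OrderIso : List ℕ → List ℕ → Set
OrderIso u v = Σ (length u ≡ length v) λ e →
  ∀ (s t : Fin (length u)) →
    ((lookup u s < lookup u t) ⇔ (lookup v (subst Fin e s) < lookup v (subst Fin e t))) ×
    ((lookup u s ≡ lookup u t) ⇔ (lookup v (subst Fin e s) ≡ lookup v (subst Fin e t)))

Contains : List ℕ → List ℕ → Set
Contains x p = ∃ λ y → (y ⊆ x) × OrderIso y p

Avoids : List ℕ → List ℕ → Set
Avoids x p = ¬ Contains x p

InA : List (List ℕ) → ℕ → List ℕ → Set
InA B n x = IsAscentSeq x × (length x ≡ n) × (∀ p → p ∈ B → Avoids x p)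
  where open import Data.List.Membership.Propositional using (_∈_)

-- An ascent sequence avoiding 010 is weakly increasing.  Inductively, such a
-- sequence ends in its maximum m, which equals its number of ascents, and it
-- takes every value 0, …, m; so the next entry x ≤ m + 1 is either m or m + 1,
-- or x < m already occurs before the final m, and then x m x is an occurrence
-- of 010.  Hence an ascent sequence with a descent contains 010.  A pattern
-- containing 10 has a descent, and a word containing that pattern inherits it,
-- because order isomorphisms reflect descents; so avoiding 010 already forces
-- avoiding the pattern.

module Submission where

open import Defs
open import Data.Bool using (if_then_else_)
open import Data.Fin using (Fin; toℕ; cast) renaming (zero to fzero; suc to fsuc)
open import Data.Fin.Properties using (subst-is-cast)
open import Data.List using (List; []; _∷_; _∷ʳ_; length; lookup; map)
open import Data.List.Properties using (length-map)
open import Data.List.Membership.Propositional using (_∈_)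
open import Data.List.Membership.Propositional.Properties using (∈-++⁻; ∈-++⁺ˡ; ∈-++⁺ʳ; ∈-lookup)
open import Data.List.Relation.Binary.Sublist.Propositional
  using (_⊆_; []; _∷_; ⊆-refl; ⊆-trans; from∈; to∈) renaming (_∷ʳ_ to skip)
open import Data.List.Relation.Binary.Sublist.Propositional.Properties using (++⁺; ++⁺ʳ)
open import Data.List.Relation.Unary.All as All using (All)
open import Data.List.Relation.Unary.All.Properties using (∷ʳ⁺)
open import Data.List.Relation.Unary.Any using (here; there; index)
open import Data.List.Relation.Unary.Any.Properties using (lookup-index)
open import Data.Nat using (ℕ; zero; suc; _≤_; _<_; _+_; _<ᵇ_; z≤n; s≤s; z<s; s<s)
open import Data.Nat.Properties
  using (≤-refl; ≤-trans; <-irrefl; ≤-antisym; <⇒≤; ≰⇒>; _≤?_; <-cmp; <⇒≢; >⇒≢; <-asym;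
         <-≤-trans; ≤-<-trans; m≤n+m; +-monoˡ-<; +-identityʳ; +-assoc)
open import Data.Product using (Σ; ∃; ∃₂; _×_; _,_; proj₁)
import Data.Product as Product
open import Data.Sum using (_⊎_; inj₁; inj₂)
import Data.Sum as Sum
open import Function.Bundles using (_⇔_; mk⇔; Equivalence)
open import Relation.Binary using (_Preserves_⟶_; tri<; tri≈; tri>)
open import Relation.Binary.PropositionalEquality using (_≡_; refl; sym; trans; cong; cong₂; subst; subst₂)
open import Relation.Nullary using (¬_; yes; no; contradiction)

module _ {f : ℕ → ℕ} (f-mono : f Preserves _<_ ⟶ _<_) where

  strictMono-reflects-< : ∀ a b → f a < f b → a < b
  strictMono-reflects-< a b fa<fb with <-cmp a b
  ... | tri< a<b _ _ = a<b
  ... | tri≈ _ refl _ = contradiction fa<fb (<-irrefl refl)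
  ... | tri> _ _ b<a = contradiction fa<fb (<-asym (f-mono b<a))

  strictMono-injective : ∀ a b → f a ≡ f b → a ≡ b
  strictMono-injective a b fa≡fb with <-cmp a b
  ... | tri< a<b _ _ = contradiction fa≡fb (<⇒≢ (f-mono a<b))
  ... | tri≈ _ a≡b _ = a≡b
  ... | tri> _ _ b<a = contradiction fa≡fb (>⇒≢ (f-mono b<a))

  lookup-map-cast : ∀ w (s : Fin (length (map f w))) →
    lookup (map f w) s ≡ f (lookup w (cast (length-map f w) s))
  lookup-map-cast (x ∷ w) fzero = refl
  lookup-map-cast (x ∷ w) (fsuc s) = lookup-map-cast w s

  map-orderIso : ∀ w → OrderIso (map f w) w
  map-orderIso w = length-map f w , λ s t → same-< s t , same-≡ s t
    where
    at : Fin (length (map f w)) → ℕ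
    at s = lookup w (subst Fin (length-map f w) s)
    lookup≡ : ∀ s → lookup (map f w) s ≡ f (at s)
    lookup≡ s = trans (lookup-map-cast w s)
                      (cong (λ i → f (lookup w i)) (sym (subst-is-cast (length-map f w) s)))
    same-< : ∀ s t → (lookup (map f w) s < lookup (map f w) t) ⇔ (at s < at t)
    same-< s t rewrite lookup≡ s | lookup≡ t =
      mk⇔ (strictMono-reflects-< (at s) (at t)) f-mono
    same-≡ : ∀ s t → (lookup (map f w) s ≡ lookup (map f w) t) ⇔ (at s ≡ at t)
    same-≡ s t rewrite lookup≡ s | lookup≡ t =
      mk⇔ (strictMono-injective (at s) (at t)) (cong f)

HasDescent : List ℕ → Set
HasDescent xs = ∃₂ λ (a b : ℕ) → b < a × (a ∷ b ∷ []) ⊆ xs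

hasDescent-mono : ∀ {xs ys} → xs ⊆ ys → HasDescent xs → HasDescent ys
hasDescent-mono xs⊆ys (a , b , b<a , ab⊆xs) = a , b , b<a , ⊆-trans ab⊆xs xs⊆ys

pair⊆⇒indices : ∀ {a b : ℕ} (xs : List ℕ) → (a ∷ b ∷ []) ⊆ xs →
  Σ (Fin (length xs)) λ i → Σ (Fin (length xs)) λ j →
    toℕ i < toℕ j × lookup xs i ≡ a × lookup xs j ≡ b
pair⊆⇒indices (x ∷ xs) (skip _ ab⊆xs) with pair⊆⇒indices xs ab⊆xs
... | i , j , i<j , refl , refl = fsuc i , fsuc j , s<s i<j , refl , refl
pair⊆⇒indices (x ∷ xs) (refl ∷ b⊆xs) =
  fzero , fsuc (index (to∈ b⊆xs)) , z<s , refl , sym (lookup-index (to∈ b⊆xs))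

indices⇒pair⊆ : ∀ (xs : List ℕ) (i j : Fin (length xs)) → toℕ i < toℕ j → (lookup xs i ∷ lookup xs j ∷ []) ⊆ xs
indices⇒pair⊆ (x ∷ xs) fzero (fsuc j) _ = refl ∷ from∈ (∈-lookup j)
indices⇒pair⊆ (x ∷ xs) (fsuc i) (fsuc j) (s<s i<j) = skip x (indices⇒pair⊆ xs i j i<j)

transport-index : ∀ {m n} (e : m ≡ n) (i : Fin n) → ∃ λ s → subst Fin e s ≡ i × toℕ s ≡ toℕ i
transport-index refl i = i , refl , refl

orderIso-reflects-descent : ∀ {u v} → OrderIso u v → HasDescent v → HasDescent u
orderIso-reflects-descent {u} {v} (e , iso) (a , b , b<a , ab⊆v) with pair⊆⇒indices v ab⊆v
... | i , j , i<j , refl , refl = reflect i j i<j b<a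
  where
  reflect : ∀ i j → toℕ i < toℕ j → lookup v j < lookup v i → HasDescent u
  reflect i j i<j vj<vi with transport-index e i | transport-index e j
  ... | s , refl , s≡i | t , refl , t≡j =
    lookup u s , lookup u t , Equivalence.from (proj₁ (iso t s)) vj<vi ,
    indices⇒pair⊆ u s t (subst₂ _<_ (sym s≡i) (sym t≡j) i<j)

contains-descent : ∀ {x p} → HasDescent p → Contains x p → HasDescent x
contains-descent desc (y , y⊆x , y≅p) = hasDescent-mono y⊆x (orderIso-reflects-descent y≅p desc)

pair⊆-∷ʳ⁻ : ∀ {a b x : ℕ} xs → (a ∷ b ∷ []) ⊆ xs ∷ʳ x → (a ∷ b ∷ []) ⊆ xs ⊎ (b ≡ x × a ∈ xs)
pair⊆-∷ʳ⁻ [] (skip _ ())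
pair⊆-∷ʳ⁻ [] (refl ∷ ())
pair⊆-∷ʳ⁻ (y ∷ xs) (skip _ ab⊆) = Sum.map (skip y) (Product.map₂ there) (pair⊆-∷ʳ⁻ xs ab⊆)
pair⊆-∷ʳ⁻ (y ∷ xs) (refl ∷ b⊆) with ∈-++⁻ xs (to∈ b⊆)
... | inj₁ b∈xs = inj₁ (refl ∷ from∈ b∈xs)
... | inj₂ (here b≡x) = inj₂ (b≡x , here refl)

contains-mono : ∀ {xs ys p} → xs ⊆ ys → Contains xs p → Contains ys p
contains-mono xs⊆ys (z , z⊆xs , z≅p) = z , ⊆-trans z⊆xs xs⊆ys , z≅p

spread : ℕ → ℕ → ℕ → ℕ
spread c d zero = c
spread c d (suc k) = k + d

spread-increasing : ∀ {c d} → c < d → spread c d Preserves _<_ ⟶ _<_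
spread-increasing {c} {d} c<d {zero} {suc b} _ = <-≤-trans c<d (m≤n+m d b)
spread-increasing c<d {suc a} {suc b} (s<s a<b) = +-monoˡ-< _ a<b

occurrence⇒contains010 : ∀ {c d xs} → c < d → (c ∷ d ∷ c ∷ []) ⊆ xs → Contains xs (0 ∷ 1 ∷ 0 ∷ [])
occurrence⇒contains010 c<d occ = _ , occ , map-orderIso (spread-increasing c<d) (0 ∷ 1 ∷ 0 ∷ [])

record Staircase (xs : List ℕ) : Set where
  constructor staircase
  field
    {init} : List ℕ
    top : ℕ
    ends-with-top : xs ≡ init ∷ʳ top
    asc≡top : asc xs ≡ top
    covers : ∀ v → v ≤ top → v ∈ xs
    bounded : All (_≤ top) xs
    descent-free : ¬ HasDescent xs

ascentIndicator : ℕ → ℕ → ℕ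
ascentIndicator m x = if m <ᵇ x then 1 else 0

asc-∷ʳ-∷ʳ : ∀ ys m x → asc ((ys ∷ʳ m) ∷ʳ x) ≡ asc (ys ∷ʳ m) + ascentIndicator m x
asc-∷ʳ-∷ʳ [] m x = +-identityʳ (ascentIndicator m x)
asc-∷ʳ-∷ʳ (y ∷ []) m x =
  cong₂ _+_ (sym (+-identityʳ (ascentIndicator y m))) (+-identityʳ (ascentIndicator m x))
asc-∷ʳ-∷ʳ (y ∷ y′ ∷ ys) m x =
  trans (cong (ascentIndicator y y′ +_) (asc-∷ʳ-∷ʳ (y′ ∷ ys) m x))
        (sym (+-assoc (ascentIndicator y y′) (asc ((y′ ∷ ys) ∷ʳ m)) (ascentIndicator m x)))

ascent-step : ∀ {m x} → m ≤ x → x ≤ suc m → m + ascentIndicator m x ≡ x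
ascent-step {zero} {zero} _ _ = refl
ascent-step {zero} {suc zero} _ _ = refl
ascent-step {zero} {suc (suc x)} _ (s≤s ())
ascent-step {suc m} {suc x} (s≤s m≤x) (s≤s x≤1+m) = cong suc (ascent-step m≤x x≤1+m)

staircase-0 : Staircase (0 ∷ [])
staircase-0 = staircase {init = []} 0 refl refl (λ { zero z≤n → here refl }) (z≤n All.∷ All.[]) λ where
  (_ , _ , _ , skip _ ())
  (_ , _ , _ , _ ∷ ())

staircase-∷ʳ : ∀ {xs} → Staircase xs → ∀ x → x ≤ suc (asc xs) →
  Contains (xs ∷ʳ x) (0 ∷ 1 ∷ 0 ∷ []) ⊎ Staircase (xs ∷ʳ x)
staircase-∷ʳ (staircase {init = ys} m refl asc≡m covers bounded descent-free) x x≤1+asc with m ≤? x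
... | no m≰x = inj₁ (occurrence⇒contains010 x<m (++⁺ (++⁺ (from∈ x∈ys) ⊆-refl) ⊆-refl))
  where
  x<m = ≰⇒> m≰x
  x∈ys : x ∈ ys
  x∈ys with ∈-++⁻ ys (covers x (<⇒≤ x<m))
  ... | inj₁ x∈ys = x∈ys
  ... | inj₂ (here x≡m) = contradiction x≡m (<⇒≢ x<m)
... | yes m≤x = inj₂ (staircase x refl asc≡x covers′ bounded′ descent-free′)
  where
  x≤1+m : x ≤ suc m
  x≤1+m = subst (λ k → x ≤ suc k) asc≡m x≤1+asc
  asc≡x : asc ((ys ∷ʳ m) ∷ʳ x) ≡ x
  asc≡x = trans (asc-∷ʳ-∷ʳ ys m x)
    (trans (cong (_+ _) asc≡m) (ascent-step m≤x x≤1+m))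
  covers′ : ∀ v → v ≤ x → v ∈ (ys ∷ʳ m) ∷ʳ x
  covers′ v v≤x with v ≤? m
  ... | yes v≤m = ∈-++⁺ˡ (covers v v≤m)
  ... | no v≰m = ∈-++⁺ʳ _ (here (≤-antisym v≤x (≤-trans x≤1+m (≰⇒> v≰m))))
  bounded′ : All (_≤ x) ((ys ∷ʳ m) ∷ʳ x)
  bounded′ = ∷ʳ⁺ (All.map (λ v≤m → ≤-trans v≤m m≤x) bounded) ≤-refl
  descent-free′ : ¬ HasDescent ((ys ∷ʳ m) ∷ʳ x)
  descent-free′ (a , b , b<a , ab⊆) with pair⊆-∷ʳ⁻ (ys ∷ʳ m) ab⊆
  ... | inj₁ ab⊆ys = descent-free (a , b , b<a , ab⊆ys)
  ... | inj₂ (refl , a∈) = <-irrefl refl (≤-<-trans (≤-trans (All.lookup bounded a∈) m≤x) b<a)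

staircase-or-contains010 : ∀ {xs} → IsAscentSeq xs → Contains xs (0 ∷ 1 ∷ 0 ∷ []) ⊎ Staircase xs
staircase-or-contains010 first = inj₂ staircase-0
staircase-or-contains010 (extend x xs-asc x≤1+asc) with staircase-or-contains010 xs-asc
... | inj₁ has010 = inj₁ (contains-mono (++⁺ʳ _ ⊆-refl) has010)
... | inj₂ stair = staircase-∷ʳ stair x x≤1+asc

descent⇒contains010 : ∀ {xs} → IsAscentSeq xs → HasDescent xs → Contains xs (0 ∷ 1 ∷ 0 ∷ [])
descent⇒contains010 xs-asc desc with staircase-or-contains010 xs-asc
... | inj₁ has010 = has010
... | inj₂ stair = contradiction desc (Staircase.descent-free stair)

avoids010⇒avoids : ∀ {x p} → IsAscentSeq x → HasDescent p →
  Avoids x (0 ∷ 1 ∷ 0 ∷ []) → Avoids x p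
avoids010⇒avoids x-asc p-descent avoid x⊇p =
  avoid (descent⇒contains010 x-asc (contains-descent p-descent x⊇p))

corollary2p2 : (p : List ℕ) → IsPattern p → Contains p (1 ∷ 0 ∷ []) →
    (n : ℕ) → 1 ≤ n → (x : List ℕ) →
    InA ((0 ∷ 1 ∷ 0 ∷ []) ∷ p ∷ []) n x ⇔ InA ((0 ∷ 1 ∷ 0 ∷ []) ∷ []) n x
corollary2p2 p _ p⊇10 _ _ x = mk⇔ forget add
  where
  p-descent : HasDescent p
  p-descent = contains-descent (1 , 0 , z<s , ⊆-refl) p⊇10
  forget : InA ((0 ∷ 1 ∷ 0 ∷ []) ∷ p ∷ []) _ x → InA ((0 ∷ 1 ∷ 0 ∷ []) ∷ []) _ x
  forget (x-asc , len , avoid) = x-asc , len , λ where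
    _ (here refl) → avoid _ (here refl)
  add : InA ((0 ∷ 1 ∷ 0 ∷ []) ∷ []) _ x → InA ((0 ∷ 1 ∷ 0 ∷ []) ∷ p ∷ []) _ x
  add (x-asc , len , avoid) = x-asc , len , λ where
    _ (here refl) → avoid _ (here refl)
    _ (there (here refl)) → avoids010⇒avoids x-asc p-descent (avoid _ (here refl))
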